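{- Let $p,q$ be patterns over $U$. If $\mathrm{sing}(p)\setminus\mathrm{lbs}(q)\neq\emptyset$, then $p\not\sim q$.
   Context: Let $U$ be a finite totally ordered set and $0\notin U$. A pattern over $U$ is a set $p$ of subsets of $U\cup\{0\}$ such that exactly one member of $p$ contains $0$. Let $\mathrm{lbs}(p)=\bigcup_{S\in p}S\setminus\{0\}$ and $\mathrm{sing}(p)=\{u\in U:\{u\}\in p\}$. For patterns $p,q$, the join $p\sqcup q$ is obtained by relating $S\in p$ and $T\in q$ whenever $S\cap T\neq\emptyset$, taking the equivalence closure of this relation on the members of $p$ and $q$, and forming the union of the members of each equivalence class. Patterns $p,q$ are consistent, $p\sim q$, if $p\sqcup q$ consists of a single set. -}

module Defs where

open import Data.Nat using (ℕ; suc)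
open import Data.Bool using (Bool; true)
open import Data.Fin using (Fin; zero; suc)
open import Data.Fin.Subset using (Subset; _∈_; _∩_; Nonempty; ⁅_⁆)
open import Data.Product using (Σ; ∃; _×_; _,_; proj₁)
open import Data.Sum using (_⊎_; inj₁; inj₂)
open import Relation.Binary.PropositionalEquality using (_≡_)
open import Relation.Nullary using (¬_)
open import Function.Bundles using (_⇔_)

-- U = Fin n (with its usual total order); U ∪ {0} is modelled as Fin (suc n),
-- where `zero` plays the role of the extra element 0 and `suc u` is u ∈ U.

SetOfSubsets : ℕ → Set
SetOfSubsets n = Subset (suc n) → Bool

record Pattern (n : ℕ) : Set where
  field
    mem      : SetOfSubsets n
    uniqueZ  : Σ (Subset (suc n)) λ S →
                 (mem S ≡ true × zero ∈ S) ×
                 (∀ T → mem T ≡ true → zero ∈ T → T ≡ S)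
open Pattern public

_∈ₚ_ : ∀ {n} → Subset (suc n) → Pattern n → Set
S ∈ₚ p = mem p S ≡ true

_∈lbs_ : ∀ {n} → Fin n → Pattern n → Set
u ∈lbs p = ∃ λ S → S ∈ₚ p × suc u ∈ S

_∈sing_ : ∀ {n} → Fin n → Pattern n → Set
u ∈sing p = ⁅ suc u ⁆ ∈ₚ p

Node : ∀ {n} → Pattern n → Pattern n → Set
Node p q = (Σ (Subset _) λ S → S ∈ₚ p) ⊎ (Σ (Subset _) λ T → T ∈ₚ q)

nodeSet : ∀ {n} {p q : Pattern n} → Node p q → Subset (suc n)
nodeSet (inj₁ x) = proj₁ x
nodeSet (inj₂ y) = proj₁ y

data Meet {n} (p q : Pattern n) : Node p q → Node p q → Set where
  meet : (S T : Subset (suc n)) (s : S ∈ₚ p) (t : T ∈ₚ q) →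
         Nonempty (S ∩ T) → Meet p q (inj₁ (S , s)) (inj₂ (T , t))

data EqClo {n} (p q : Pattern n) : Node p q → Node p q → Set where
  base : ∀ {a b} → Meet p q a b → EqClo p q a b
  rfl  : ∀ {a} → EqClo p q a a
  sym  : ∀ {a b} → EqClo p q a b → EqClo p q b a
  trn  : ∀ {a b c} → EqClo p q a b → EqClo p q b c → EqClo p q a c

IsClassUnion : ∀ {n} (p q : Pattern n) → Node p q → Subset (suc n) → Set
IsClassUnion p q a X =
  ∀ x → (x ∈ X) ⇔ (∃ λ b → EqClo p q a b × x ∈ nodeSet {p = p} {q = q} b)

_∈⊔[_,_] : ∀ {n} → Subset (suc n) → Pattern n → Pattern n → Set
X ∈⊔[ p , q ] = ∃ λ a → IsClassUnion p q a X

_∼_ : ∀ {n} → Pattern n → Pattern n → Set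
p ∼ q = ∃ λ X → ∀ Y → (Y ∈⊔[ p , q ]) ⇔ (Y ≡ X)

{-# OPTIONS --safe #-}
module Submission where

-- If u ∈ sing(p) lies in no member of q, the member {u} of p meets no member of q, so its
-- class in the join is {{u}} alone and {u} ∈ p ⊔ q. The class of the member of p containing
-- 0 has a union containing 0, which therefore differs from {u}: the join has two sets.
-- Class unions need not be constructible, but since the goal is ⊥ we may assume class
-- membership decidable, which is classically true over the finite set U ∪ {0}.

open import Defs
open import Data.Nat using (ℕ; suc)
open import Data.Empty using (⊥-elim)
open import Data.Fin using (Fin; zero; suc)
open import Data.Fin.Subset using (Subset; _∈_; _∩_; ⁅_⁆; Empty)
open import Data.Fin.Properties using (0≢1+n)
open import Data.Fin.Subset.Properties using (x∈⁅y⁆⇒x≡y; x∈p∩q⁻)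
open import Data.Product using (∃; _×_; _,_)
open import Data.Sum using (inj₁)
open import Data.Vec using (tabulate)
open import Data.Vec.Properties using ([]=↔lookup; lookup∘tabulate)
open import Effect.Monad using (RawMonad)
open import Level using (0ℓ)
open import Function using (_∘_)
open import Function.Bundles using (_⇔_; mk⇔; Equivalence; Inverse)
open import Function.Construct.Composition using (_⇔-∘_)
open import Function.Construct.Identity using (⇔-id)
open import Function.Construct.Symmetry using (⇔-sym)
open import Relation.Binary.PropositionalEquality as ≡ using (_≡_; refl; subst)
open import Relation.Nullary using (¬_; does; proof)
open import Relation.Nullary.Decidable using (dec-true)
open import Relation.Nullary.Reflects using (Reflects; invert)
open import Relation.Nullary.Decidable.Core using (¬¬-excluded-middle)
open import Relation.Nullary.Negation using (¬¬-Monad)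
open import Relation.Unary using (Pred; Decidable)

open RawMonad (¬¬-Monad {0ℓ})

¬¬-decidable : ∀ {m} (P : Pred (Fin m) 0ℓ) → ¬ ¬ Decidable P
¬¬-decidable {ℕ.zero} P k = k (λ ())
¬¬-decidable {suc m} P = do
  P0? ← ¬¬-excluded-middle
  Psuc? ← ¬¬-decidable (P ∘ suc)
  pure λ { zero → P0? ; (suc x) → Psuc? x }

subset : ∀ {m} {P : Pred (Fin m) 0ℓ} → Decidable P → Subset m
subset P? = tabulate (does ∘ P?)

∈-subset : ∀ {m} {P : Pred (Fin m) 0ℓ} (P? : Decidable P) x → x ∈ subset P? ⇔ P x
∈-subset {P = P} P? x = mk⇔
  (λ x∈ → invert (subst (Reflects (P x))
    (≡.trans (≡.sym (lookup∘tabulate (does ∘ P?) x)) (Inverse.to []=↔lookup x∈)) (proof (P? x))))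
  (λ Px → Inverse.from []=↔lookup (≡.trans (lookup∘tabulate (does ∘ P?) x) (dec-true (P? x) Px)))

module _ {n : ℕ} (p q : Pattern n) where

  ¬¬-classUnion : (a : Node p q) → ¬ ¬ ∃ (IsClassUnion p q a)
  ¬¬-classUnion a = do
    inClass? ← ¬¬-decidable inClass
    pure (subset inClass? , ∈-subset inClass?)
    where
    inClass : Pred (Fin (suc n)) 0ℓ
    inClass x = ∃ λ b → EqClo p q a b × x ∈ nodeSet {p = p} {q = q} b

  ∼⇒⊔-unique : p ∼ q → ∀ {X Y} → X ∈⊔[ p , q ] → Y ∈⊔[ p , q ] → X ≡ Y
  ∼⇒⊔-unique (Z , ⊔≡Z) X∈⊔ Y∈⊔ =
    ≡.trans (Equivalence.to (⊔≡Z _) X∈⊔) (≡.sym (Equivalence.to (⊔≡Z _) Y∈⊔))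

  ∈-classUnion : ∀ {a X} → IsClassUnion p q a X → ∀ {x} → x ∈ nodeSet {p = p} {q = q} a → x ∈ X
  ∈-classUnion a-class x∈a = Equivalence.from (a-class _) (_ , rfl , x∈a)

  module Isolated {S : Subset (suc n)} (S∈p : S ∈ₚ p)
                  (apart : ∀ T → T ∈ₚ q → Empty (S ∩ T)) where

    node : Node p q
    node = inj₁ (S , S∈p)

    EqClo-isolated : ∀ {a b} → EqClo p q a b → (a ≡ node) ⇔ (b ≡ node)
    EqClo-isolated (base (meet _ T _ T∈q S∩T≠∅)) =
      mk⇔ (λ { refl → ⊥-elim (apart T T∈q S∩T≠∅) }) (λ ())
    EqClo-isolated rfl        = ⇔-id _
    EqClo-isolated (sym r)    = ⇔-sym (EqClo-isolated r)
    EqClo-isolated (trn r r′) = EqClo-isolated r′ ⇔-∘ EqClo-isolated r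

    isolated∈⊔ : S ∈⊔[ p , q ]
    isolated∈⊔ = node , λ x → mk⇔ (λ x∈S → node , rfl , x∈S) λ where
      (b , r , x∈b) → subst (λ c → x ∈ nodeSet {p = p} {q = q} c)
                            (Equivalence.to (EqClo-isolated r) refl) x∈b

singleton-apart : ∀ {n} {q : Pattern n} {u} → ¬ (u ∈lbs q) → ∀ T → T ∈ₚ q → Empty (⁅ suc u ⁆ ∩ T)
singleton-apart {u = u} u∉lbs T T∈q (x , x∈⁅u⁆∩T) with x∈p∩q⁻ ⁅ suc u ⁆ T x∈⁅u⁆∩T
... | x∈⁅u⁆ , x∈T with x∈⁅y⁆⇒x≡y (suc u) x∈⁅u⁆
... | refl = u∉lbs (T , T∈q , x∈T)

lemma4p13 : ∀ {n : ℕ} (p q : Pattern n) →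
              (∃ λ u → u ∈sing p × ¬ (u ∈lbs q)) →
              ¬ (p ∼ q)
lemma4p13 p q (u , u∈sing , u∉lbs) p∼q with uniqueZ p
... | Z , (Z∈p , 0∈Z) , _ = ¬¬-classUnion p q zeroNode λ (Y , Y-class) →
  let Y≡⁅u⁆ = ∼⇒⊔-unique p q p∼q (zeroNode , Y-class) singleton∈⊔
      0∈⁅u⁆ = subst (zero ∈_) Y≡⁅u⁆ (∈-classUnion p q Y-class 0∈Z)
  in 0≢1+n (x∈⁅y⁆⇒x≡y (suc u) 0∈⁅u⁆)
  where
  zeroNode : Node p q
  zeroNode = inj₁ (Z , Z∈p)

  singleton∈⊔ : ⁅ suc u ⁆ ∈⊔[ p , q ]
  singleton∈⊔ = Isolated.isolated∈⊔ p q u∈sing (singleton-apart {q = q} u∉lbs)
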